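{- Let $n\ge3$, $k\ge0$ and let $S$ be an independent set in $G_n^k$. If $S$ contains pairs $(a_1,y)$ and $(x,b_{k+2})$ with $a_1\preceq y\prec x\preceq b_{k+2}$, then $|B(a_1,S)|+|A(b_{k+2},S)|\le k+3-n$.
   Context: The crown $S_n^k$ is the height-2 poset on $A\cup B$, $A=\{a_1,\dots,a_{n+k}\}$ minimal, $B=\{b_1,\dots,b_{n+k}\}$ maximal, indices cyclic mod $n+k$; $a_i$ is incomparable to $b_j$ iff $j\in\{i,\dots,i+k\}$ (mod $n+k$), otherwise $a_i<b_j$. $\mathrm{Inc}(A,B)$: incomparable pairs $(a,b)\in A\times B$; $G_n^k$: graph on $\mathrm{Inc}(A,B)$ with $(a,b)\sim(x,y)$ iff $a<y$ and $x<b$. Place points $u_1,\dots,u_{n+k}$ clockwise on a circle, with $a_i$ and $b_i$ both at $u_i$; $v_1\preceq v_2\preceq\cdots\preceq v_\ell$ means that traversing clockwise from the position of $v_1$ and stopping the first time the position of $v_\ell$ is reached, one visits the positions of $v_2,\dots,v_{\ell-1}$ in that order, with $\preceq$ allowing equal positions and $\prec$ requiring distinct positions. $B(a,S)=\{b:(a,b)\in S\}$, $A(b,S)=\{a:(a,b)\in S\}$. -}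

module Defs where

open import Data.Nat using (ℕ; _+_; _∸_; _≤_; _<_; _≤?_)
open import Data.Fin using (Fin; toℕ)
open import Data.Fin.Subset using (Subset)
open import Data.Bool using (Bool; T)
open import Data.Vec using (tabulate)
open import Data.Product using (_×_)
open import Relation.Nullary using (¬_; yes; no)

-- Crown S_n^k with N = n + k points u_0,...,u_{N-1} on a circle (0-based:
-- paper index i corresponds to Fin element i - 1).  a_i and b_i sit at u_i.

cw : ∀ {N} → Fin N → Fin N → ℕ
cw {N} p q with toℕ p ≤? toℕ q
... | yes _ = toℕ q ∸ toℕ p
... | no _ = (toℕ q + N) ∸ toℕ p

-- a_i incomparable to b_j  iff  j ∈ {i, ..., i+k} (mod N)
Incomp : (n k : ℕ) → Fin (n + k) → Fin (n + k) → Set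
Incomp n k i j = cw i j ≤ k

Less : (n k : ℕ) → Fin (n + k) → Fin (n + k) → Set
Less n k i j = ¬ Incomp n k i j

PairSet : ℕ → Set
PairSet N = Fin N → Fin N → Bool

_∈S_ : ∀ {N} → Fin N × Fin N → PairSet N → Set
_∈S_ (i Data.Product., j) S = T (S i j)

-- S ⊆ Inc(A,B) and S is independent in G_n^k:
-- (a,b) ~ (x,y) iff a < y and x < b.
Independent : (n k : ℕ) → PairSet (n + k) → Set
Independent n k S =
  (∀ i j → T (S i j) → Incomp n k i j) ×
  (∀ i j x y → T (S i j) → T (S x y) → ¬ (Less n k i y × Less n k x j))

Bof : ∀ {N} → PairSet N → Fin N → Subset N
Bof S i = tabulate (λ j → S i j)

Aof : ∀ {N} → PairSet N → Fin N → Subset N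
Aof S j = tabulate (λ i → S i j)

Chain⪯≺⪯ : ∀ {N} → Fin N → Fin N → Fin N → Fin N → Set
Chain⪯≺⪯ p1 p2 p3 p4 = (cw p1 p2 < cw p1 p3) × (cw p1 p3 ≤ cw p1 p4)

module Submission where

-- Measure positions clockwise from a₁ = u₁. Then B(a₁,S) lies in [0,k], A(b_{k+2},S) in [1,k+1],
-- and since a₁ < b_{k+2}, independence forces j + n ≤ i whenever j ∈ B(a₁,S) precedes i ∈ A(b_{k+2},S).
-- Take such a pair j < i with nothing of either set strictly between (it exists because y < x).
-- Away from it a position of B is never directly followed by one of A, so counting B on a window
-- together with A on the window shifted by one gives at most the window length; the block [j, i]
-- contributes only 2 although it has length i - j + 1 ≥ n + 1. Hence |B| + |A| ≤ (k + 1) + 2 - n.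

open import Defs
open import Data.Nat using (ℕ; zero; suc; _+_; _∸_; _≤_; _<_; _≤?_; z≤n; s≤s; s≤s⁻¹)
open import Data.Nat.Properties
open import Data.Nat.Tactic.RingSolver using (solve-∀)
open import Algebra.Properties.CommutativeSemigroup +-commutativeSemigroup using (interchange)
open import Data.Bool using (Bool; true; false; T; if_then_else_)
open import Data.Bool.Properties using (T-≡)
open import Data.Fin as Fin using (Fin; toℕ)
open import Data.Fin.Properties using (toℕ<n)
open import Data.Fin.Subset using (∣_∣)
open import Data.Vec using (tabulate)
open import Data.Unit using (tt)
open import Data.Empty using (⊥-elim)
open import Data.Sum using (inj₁; inj₂)
open import Data.Product using (Σ; _×_; _,_; proj₁; proj₂)
open import Function.Bundles using (Equivalence)
open import Relation.Nullary using (¬_; yes; no)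
open import Relation.Nullary.Decidable using (decidable-stable)
open import Relation.Binary.PropositionalEquality
  using (_≡_; refl; sym; trans; cong; cong₂; subst; subst₂; module ≡-Reasoning)

count : (ℕ → Bool) → ℕ → ℕ → ℕ
count f lo zero = 0
count f lo (suc m) = if f lo then suc (count f (suc lo) m) else count f (suc lo) m

count-≤ : ∀ f lo m → count f lo m ≤ m
count-≤ f lo zero = z≤n
count-≤ f lo (suc m) with f lo
... | true = s≤s (count-≤ f (suc lo) m)
... | false = m≤n⇒m≤1+n (count-≤ f (suc lo) m)

count-++ : ∀ f lo a b → count f lo (a + b) ≡ count f lo a + count f (lo + a) b
count-++ f lo zero b = cong (λ l → count f l b) (sym (+-identityʳ lo))
count-++ f lo (suc a) b rewrite +-suc lo a with f lo
... | true = cong suc (count-++ f (suc lo) a b)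
... | false = count-++ f (suc lo) a b

count-shift : ∀ f lo m → count f (suc lo) m ≡ count (λ t → f (suc t)) lo m
count-shift f lo zero = refl
count-shift f lo (suc m) with f (suc lo)
... | true = cong suc (count-shift f (suc lo) m)
... | false = count-shift f (suc lo) m

count-none : ∀ f lo m → (∀ t → lo ≤ t → t < lo + m → ¬ T (f t)) → count f lo m ≡ 0
count-none f lo zero none = refl
count-none f lo (suc m) none with f lo | none lo ≤-refl (m<m+n lo (s≤s z≤n))
... | true | ¬flo = ⊥-elim (¬flo tt)
... | false | _ = count-none f (suc lo) m
  (λ t lo<t t<lo+1+m → none t (<⇒≤ lo<t) (subst (t <_) (sym (+-suc lo m)) t<lo+1+m))

count-support : ∀ f lo m N → lo + m ≤ N → (∀ t → T (f t) → lo ≤ t × t < lo + m) →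
  count f 0 N ≡ count f lo m
count-support f lo m N lo+m≤N support with m≤n⇒∃[o]m+o≡n lo+m≤N
... | r , refl = begin
  count f 0 (lo + m + r)                      ≡⟨ count-++ f 0 (lo + m) r ⟩
  count f 0 (lo + m) + count f (lo + m) r     ≡⟨ cong₂ _+_ (count-++ f 0 lo m) (count-none f (lo + m) r above) ⟩
  count f 0 lo + count f lo m + 0             ≡⟨ cong (λ c → c + count f lo m + 0) (count-none f 0 lo below) ⟩
  count f lo m + 0                            ≡⟨ +-identityʳ _ ⟩
  count f lo m                                ∎
  where
  open ≡-Reasoning
  below : ∀ t → 0 ≤ t → t < lo → ¬ T (f t)
  below t _ t<lo ft = <⇒≱ t<lo (proj₁ (support t ft))
  above : ∀ t → lo + m ≤ t → t < lo + m + r → ¬ T (f t)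
  above t lo+m≤t _ ft = <⇒≱ (proj₂ (support t ft)) lo+m≤t

module Window (β α : ℕ → Bool) where

  load : ℕ → ℕ → ℕ
  load lo m = count β lo m + count α (suc lo) m

  load-++ : ∀ lo a b → load lo (a + b) ≡ load lo a + load (lo + a) b
  load-++ lo a b = begin
    count β lo (a + b) + count α (suc lo) (a + b)
      ≡⟨ cong₂ _+_ (count-++ β lo a b) (count-++ α (suc lo) a b) ⟩
    (count β lo a + count β (lo + a) b) + (count α (suc lo) a + count α (suc lo + a) b)
      ≡⟨ interchange (count β lo a) _ _ _ ⟩
    load lo a + load (lo + a) b ∎
    where open ≡-Reasoning

  NoAdjacent : Set
  NoAdjacent = ∀ t → T (β t) → ¬ T (α (suc t))

  load-≤ : NoAdjacent → ∀ lo m → load lo m ≤ m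
  load-≤ noAdj lo zero = z≤n
  load-≤ noAdj lo (suc m) with β lo | α (suc lo) | noAdj lo | load-≤ noAdj (suc lo) m
  ... | true  | true  | adj | _  = ⊥-elim (adj tt tt)
  ... | true  | false | _   | ih = s≤s ih
  ... | false | true  | _   | ih = subst (_≤ suc m) (sym (+-suc _ _)) (s≤s ih)
  ... | false | false | _   | ih = m≤n⇒m≤1+n ih

  EmptyBetween : ℕ → ℕ → Set
  EmptyBetween j i = ∀ t → j < t → t < i → ¬ T (β t) × ¬ T (α t)

  nothing-between : ∀ j → EmptyBetween j (suc j)
  nothing-between j t j<t t<1+j = ⊥-elim (<⇒≱ j<t (s≤s⁻¹ t<1+j))

  load-gap : ∀ j g → EmptyBetween j (suc j + g) → load j (suc g) ≤ 2
  load-gap j g empty = begin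
    count β j (suc g) + count α (suc j) (suc g)
      ≡⟨ cong (count β j (suc g) +_) (trans (cong (count α (suc j)) (+-comm 1 g)) (count-++ α (suc j) g 1)) ⟩
    count β j (suc g) + (count α (suc j) g + count α (suc j + g) 1)
      ≤⟨ +-mono-≤ β-head (+-mono-≤ (≤-reflexive (count-none α (suc j) g (λ t j<t t<i → proj₂ (empty t j<t t<i))))
                                   (count-≤ α _ 1)) ⟩
    2 ∎
    where
    open ≤-Reasoning
    no-β : count β (suc j) g ≡ 0
    no-β = count-none β (suc j) g (λ t j<t t<i → proj₁ (empty t j<t t<i))
    β-head : count β j (suc g) ≤ 1
    β-head with β j
    ... | true = s≤s (≤-reflexive no-β)
    ... | false = ≤-trans (≤-reflexive no-β) z≤n

  record ClosePair (bound : ℕ) : Set where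
    field
      left right : ℕ
      left<right : left < right
      β-left : T (β left)
      α-right : T (α right)
      right≤bound : right ≤ bound
      empty : EmptyBetween left right

  private
    T-of : ∀ {b} → b ≡ true → T b
    T-of = Equivalence.from T-≡

  -- Scans p = j+1, j+2, …, i, moving the β-end forward past every β and stopping at the first α.
  scan : ∀ m {j p i} → p + m ≡ i → T (β j) → T (α i) → j < p → EmptyBetween j p → ClosePair i
  scan zero {j} {p} p+0≡i βj αi j<p empty = record
    { left = j ; right = p ; left<right = j<p ; β-left = βj
    ; α-right = subst (λ x → T (α x)) (sym p≡i) αi ; right≤bound = ≤-reflexive p≡i ; empty = empty }
    where p≡i = trans (sym (+-identityʳ p)) p+0≡i
  scan (suc m) {j} {p} {i} p+1+m≡i βj αi j<p empty with α p in αp | β p in βp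
  ... | true | _ = record
    { left = j ; right = p ; left<right = j<p ; β-left = βj ; α-right = T-of αp
    ; right≤bound = subst (p ≤_) p+1+m≡i (m≤m+n p (suc m)) ; empty = empty }
  ... | false | true = scan m (trans (sym (+-suc p m)) p+1+m≡i) (T-of βp) αi ≤-refl (nothing-between p)
  ... | false | false = scan m (trans (sym (+-suc p m)) p+1+m≡i) βj αi (m≤n⇒m≤1+n j<p) empty′
    where
    empty′ : EmptyBetween j (suc p)
    empty′ t j<t t<1+p with m≤n⇒m<n∨m≡n (s≤s⁻¹ t<1+p)
    ... | inj₁ t<p = empty t j<t t<p
    ... | inj₂ refl = subst T βp , subst T αp

  closest-pair : ∀ {j i} → T (β j) → T (α i) → j < i → ClosePair i
  closest-pair {j} βj αi j<i with m≤n⇒∃[o]m+o≡n j<i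
  ... | m , 1+j+m≡i = scan m 1+j+m≡i βj αi ≤-refl (nothing-between j)

  load-around-gap : NoAdjacent → ∀ j g r → EmptyBetween j (suc j + g) →
    load 0 (suc j + g + r) ≤ j + 2 + r
  load-around-gap noAdj j g r empty = begin
    load 0 (suc j + g + r)                            ≡⟨ load-++ 0 (suc j + g) r ⟩
    load 0 (suc j + g) + load (suc j + g) r           ≡⟨ cong (λ x → load 0 x + load (suc j + g) r) (sym (+-suc j g)) ⟩
    load 0 (j + suc g) + load (suc j + g) r           ≡⟨ cong (_+ load (suc j + g) r) (load-++ 0 j (suc g)) ⟩
    load 0 j + load j (suc g) + load (suc j + g) r    ≤⟨ +-mono-≤ (+-mono-≤ (load-≤ noAdj 0 j) (load-gap j g empty))
                                                                  (load-≤ noAdj (suc j + g) r) ⟩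
    j + 2 + r                                         ∎
    where open ≤-Reasoning

  Separated : ℕ → Set
  Separated n = ∀ j i → T (β j) → T (α i) → j < i → j + n ≤ i

  separated⇒noAdjacent : ∀ {n} → 2 ≤ n → Separated n → NoAdjacent
  separated⇒noAdjacent {n} 2≤n sep t βt αt+1 = 1+n≰n (begin
    suc (suc t) ≡⟨ +-comm 2 t ⟩
    t + 2       ≤⟨ +-monoʳ-≤ t 2≤n ⟩
    t + n       ≤⟨ sep t (suc t) βt αt+1 ≤-refl ⟩
    suc t       ∎)
    where open ≤-Reasoning

  load-separated : ∀ {n j i L} → 2 ≤ n → Separated n → T (β j) → T (α i) → j < i → i ≤ L →
    load 0 L + n ≤ L + 2
  load-separated {n} 2≤n sep βj αi j<i i≤L with closest-pair βj αi j<i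
  ... | record { left = j ; right = i′ ; left<right = j<i′ ; β-left = βj′ ; α-right = αi′
               ; right≤bound = i′≤i ; empty = empty }
    with m≤n⇒∃[o]m+o≡n j<i′ | m≤n⇒∃[o]m+o≡n (≤-trans i′≤i i≤L)
  ... | g , refl | r , refl = begin
    load 0 (suc j + g + r) + n  ≤⟨ +-mono-≤ (load-around-gap noAdj j g r empty) n≤1+g ⟩
    j + 2 + r + suc g           ≡⟨ rearrange j g r ⟩
    suc j + g + r + 2           ∎
    where
    open ≤-Reasoning
    noAdj : NoAdjacent
    noAdj = separated⇒noAdjacent 2≤n sep
    n≤1+g : n ≤ suc g
    n≤1+g = +-cancelˡ-≤ j n (suc g)
      (subst (j + n ≤_) (sym (+-suc j g)) (sep j (suc j + g) βj′ αi′ j<i′))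
    rearrange : ∀ j g r → j + 2 + r + suc g ≡ suc j + g + r + 2
    rearrange = solve-∀

-- g read as a function on ℕ, false from m on.
atℕ : ∀ {m} → (Fin m → Bool) → ℕ → Bool
atℕ {zero} g t = false
atℕ {suc m} g zero = g Fin.zero
atℕ {suc m} g (suc t) = atℕ (λ i → g (Fin.suc i)) t

∣tabulate∣≡count : ∀ {m} (g : Fin m → Bool) → ∣ tabulate g ∣ ≡ count (atℕ g) 0 m
∣tabulate∣≡count {zero} g = refl
∣tabulate∣≡count {suc m} g
  with g Fin.zero | trans (∣tabulate∣≡count (λ i → g (Fin.suc i))) (sym (count-shift (atℕ g) 0 m))
... | true  | rest = cong suc rest
... | false | rest = rest

atℕ-toℕ : ∀ {m} (g : Fin m → Bool) (i : Fin m) → atℕ g (toℕ i) ≡ g i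
atℕ-toℕ g Fin.zero = refl
atℕ-toℕ g (Fin.suc i) = atℕ-toℕ (λ j → g (Fin.suc j)) i

atℕ-true : ∀ {m} (g : Fin m → Bool) t → T (atℕ g t) → Σ (Fin m) λ i → toℕ i ≡ t × T (g i)
atℕ-true {suc m} g zero gt = Fin.zero , refl , gt
atℕ-true {suc m} g (suc t) gt with atℕ-true (λ i → g (Fin.suc i)) t gt
... | i , i≡t , gi = Fin.suc i , cong suc i≡t , gi

cw-≤ : ∀ {N} {p q : Fin N} → toℕ p ≤ toℕ q → cw p q ≡ toℕ q ∸ toℕ p
cw-≤ {p = p} {q} p≤q with toℕ p ≤? toℕ q
... | yes _ = refl
... | no p≰q = ⊥-elim (p≰q p≤q)

cw-> : ∀ {N} {p q : Fin N} → toℕ q < toℕ p → cw p q ≡ toℕ q + N ∸ toℕ p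
cw-> {p = p} {q} q<p with toℕ p ≤? toℕ q
... | yes p≤q = ⊥-elim (<⇒≱ q<p p≤q)
... | no _ = refl

cw-from-zero : ∀ {N} {p q : Fin N} → toℕ p ≡ 0 → cw p q ≡ toℕ q
cw-from-zero {q = q} p≡0 = trans (cw-≤ (subst (_≤ toℕ q) (sym p≡0) z≤n)) (cong (toℕ q ∸_) p≡0)

cw-wrap-> : ∀ {N} {p q : Fin N} → toℕ q < toℕ p → toℕ q < cw p q
cw-wrap-> {N} {p} {q} q<p = begin-strict
  toℕ q                <⟨ m<m+n (toℕ q) (m<n⇒0<n∸m (toℕ<n p)) ⟩
  toℕ q + (N ∸ toℕ p)  ≡⟨ sym (+-∸-assoc (toℕ q) (<⇒≤ (toℕ<n p))) ⟩
  toℕ q + N ∸ toℕ p    ≡⟨ sym (cw-> q<p) ⟩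
  cw p q               ∎
  where open ≤-Reasoning

cw-wrap-≤⇒+n≤ : ∀ {n k} {p q : Fin (n + k)} → toℕ q < toℕ p → cw p q ≤ k → toℕ q + n ≤ toℕ p
cw-wrap-≤⇒+n≤ {n} {k} {p} {q} q<p cw≤k = +-cancelʳ-≤ k (toℕ q + n) (toℕ p) (begin
  toℕ q + n + k                   ≡⟨ +-assoc (toℕ q) n k ⟩
  toℕ q + (n + k)                 ≡⟨ sym (m∸n+n≡m p≤q+N) ⟩
  toℕ q + (n + k) ∸ toℕ p + toℕ p ≡⟨ cong (_+ toℕ p) (sym (cw-> q<p)) ⟩
  cw p q + toℕ p                  ≤⟨ +-monoˡ-≤ (toℕ p) cw≤k ⟩
  k + toℕ p                       ≡⟨ +-comm k (toℕ p) ⟩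
  toℕ p + k                       ∎)
  where
  open ≤-Reasoning
  p≤q+N : toℕ p ≤ toℕ q + (n + k)
  p≤q+N = ≤-trans (<⇒≤ (toℕ<n p)) (m≤n+m (n + k) (toℕ q))

module Crown (n k : ℕ) (S : PairSet (n + k)) (indep : Independent n k S)
  (a₁ b : Fin (n + k)) (a₁≡0 : toℕ a₁ ≡ 0) (b≡1+k : toℕ b ≡ suc k) (2≤n : 2 ≤ n) where

  β α : ℕ → Bool
  β = atℕ (λ j → S a₁ j)
  α = atℕ (λ i → S i b)

  open Window β α public

  β-support : ∀ t → T (β t) → 0 ≤ t × t < 0 + suc k
  β-support t βt with atℕ-true (λ j → S a₁ j) t βt
  ... | j , refl , a₁j = z≤n , s≤s (subst (_≤ k) (cw-from-zero a₁≡0) (proj₁ indep a₁ j a₁j))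

  α-support : ∀ t → T (α t) → 1 ≤ t × t < 1 + suc k
  α-support t αt with atℕ-true (λ i → S i b) t αt
  ... | i , refl , ib with ≤-<-connex (toℕ i) (toℕ b) | proj₁ indep i b ib
  ...   | inj₁ i≤b | cw≤k = 1≤i , s≤s (subst (toℕ i ≤_) b≡1+k i≤b)
    where
    1≤i : 1 ≤ toℕ i
    1≤i = +-cancelʳ-≤ k 1 (toℕ i) (begin
      suc k                 ≡⟨ sym b≡1+k ⟩
      toℕ b                 ≤⟨ m≤n+m∸n (toℕ b) (toℕ i) ⟩
      toℕ i + (toℕ b ∸ toℕ i) ≡⟨ cong (toℕ i +_) (sym (cw-≤ i≤b)) ⟩
      toℕ i + cw i b        ≤⟨ +-monoʳ-≤ (toℕ i) cw≤k ⟩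
      toℕ i + k             ∎)
      where open ≤-Reasoning
  ...   | inj₂ b<i | cw≤k =
    ⊥-elim (1+n≰n (≤-trans (subst (_< cw i b) b≡1+k (cw-wrap-> b<i)) (m≤n⇒m≤1+n cw≤k)))

  separated : Separated n
  separated j i βj αi j<i with atℕ-true (λ j → S a₁ j) j βj | atℕ-true (λ i → S i b) i αi
  ... | jF , refl , a₁j | iF , refl , ib = cw-wrap-≤⇒+n≤ j<i iF≁jF
    where
    a₁<b : Less n k a₁ b
    a₁<b cw≤k = 1+n≰n (subst (_≤ k) (trans (cw-from-zero a₁≡0) b≡1+k) cw≤k)
    iF≁jF : Incomp n k iF jF
    iF≁jF = decidable-stable (cw iF jF ≤? k) (λ iF<jF → proj₂ indep a₁ jF iF b a₁j ib (a₁<b , iF<jF))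

  2+k≤n+k : 2 + k ≤ n + k
  2+k≤n+k = +-monoˡ-≤ k 2≤n

  B-count : ∣ Bof S a₁ ∣ ≡ count β 0 (suc k)
  B-count = trans (∣tabulate∣≡count (λ j → S a₁ j))
    (count-support β 0 (suc k) (n + k) (≤-trans (n≤1+n _) 2+k≤n+k) β-support)

  A-count : ∣ Aof S b ∣ ≡ count α 1 (suc k)
  A-count = trans (∣tabulate∣≡count (λ i → S i b))
    (count-support α 1 (suc k) (n + k) 2+k≤n+k α-support)

lemma6p6 : (n k : ℕ) → 3 ≤ n → (S : PairSet (n + k)) → Independent n k S →
    (a₁ bk2 : Fin (n + k)) → toℕ a₁ ≡ 0 → toℕ bk2 ≡ suc k →
    (x y : Fin (n + k)) → (a₁ , y) ∈S S → (x , bk2) ∈S S →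
    Chain⪯≺⪯ a₁ y x bk2 →
    ∣ Bof S a₁ ∣ + ∣ Aof S bk2 ∣ + n ≤ k + 3
-- The second half of the chain, x ⪯ b_{k+2}, already follows from (x , b_{k+2}) ∈ S.
lemma6p6 n k 3≤n S indep a₁ b a₁≡0 b≡1+k x y a₁y∈S xb∈S (y≺x , _) = begin
  ∣ Bof S a₁ ∣ + ∣ Aof S b ∣ + n  ≡⟨ cong (_+ n) (cong₂ _+_ B-count A-count) ⟩
  load 0 (suc k) + n              ≤⟨ load-separated 2≤n separated βy αx y<x x≤1+k ⟩
  suc k + 2                       ≡⟨ sym (+-suc k 2) ⟩
  k + 3                           ∎
  where
  2≤n : 2 ≤ n
  2≤n = ≤-trans (n≤1+n 2) 3≤n
  open Crown n k S indep a₁ b a₁≡0 b≡1+k 2≤n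
  open ≤-Reasoning
  βy : T (β (toℕ y))
  βy = subst T (sym (atℕ-toℕ (λ j → S a₁ j) y)) a₁y∈S
  αx : T (α (toℕ x))
  αx = subst T (sym (atℕ-toℕ (λ i → S i b) x)) xb∈S
  y<x : toℕ y < toℕ x
  y<x = subst₂ _<_ (cw-from-zero a₁≡0) (cw-from-zero a₁≡0) y≺x
  x≤1+k : toℕ x ≤ suc k
  x≤1+k = s≤s⁻¹ (proj₂ (α-support (toℕ x) αx))
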